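{- Let $N$ be a positive integer divisible by $8$ and consider the functions \[F_A(q)=\frac{\theta_{A_1(2)^{N/2}}(q)}{\eta(q^2)^{N/2}},\qquad F_D(q)=\frac{\theta_{D_{N/2}^*(2)}(q)}{\eta(q^2)^{N/2}},\qquad F_V(q)=\operatorname{Ch}V_{D_{N/2}}(q^2)=\frac{\theta_{D_{N/2}}(q^2)}{\eta(q^2)^{N/2}},\] each of the form $q^{ -N/24}\sum_{n\ge0}c_nq^n$. (1) $F_A$ and $F_D$ have the same coefficients $c_n$ for all even $n$ when $N\equiv8\pmod{16}$, and for all odd $n$ when $N\equiv0\pmod{16}$. (2) When $N\equiv8\pmod{16}$, $F_V$ has the same coefficients $c_n$ as $F_A$ and as $F_D$ for all even $n$.
   Context: $\theta_M(q)=\sum_{\lambda\in M}q^{\langle\lambda,\lambda\rangle/2}$, $\eta(q)=q^{1/24}\prod_{n\ge1}(1-q^n)$. $A_1(2)^{N/2}$ is $\mathbb{Z}^{N/2}$ with twice the standard form; $D_n=\{x\in\mathbb{Z}^n:\sum x_i\text{ even}\}$ with the standard form, $D_n^*$ its dual, $M(2)$ denotes $M$ with form doubled. $V_{D_n}$ is the lattice vertex operator algebra of $D_n$, whose character is $\theta_{D_n}(q)/\eta(q)^n$. In the paper $F_A$ and $F_D$ are the theta quotients $\theta_{L^g}/\eta_g$ of sublattices of a code-lattice fixed by automorphisms of cycle type $2^{N/2}$ with fixed sublattices isometric to $A_1(2)^{N/2}$ and $D_{N/2}^*(2)$ respectively. -}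

module Defs where

open import Data.Bool using (Bool; true; false; not; _∧_; _∨_; if_then_else_)
open import Data.Nat as ℕ using (ℕ; zero; suc; _≡ᵇ_)
open import Data.Nat.DivMod using (_%_; _/_)
open import Data.Integer as ℤ using (ℤ; +_; ∣_∣)
open import Data.List using (List; []; _∷_; map; concatMap; length; filterᵇ; upTo; foldr; sum)
open import Data.Vec using (Vec; []; _∷_)

PS : Set
PS = ℕ → ℤ

Σ≤ : ℕ → (ℕ → ℤ) → ℤ
Σ≤ zero    f = f 0
Σ≤ (suc n) f = Σ≤ n f ℤ.+ f (suc n)

_⊛_ : PS → PS → PS
(a ⊛ b) n = Σ≤ n (λ i → a i ℤ.* b (n ℕ.∸ i))
infixl 7 _⊛_

one : PS
one zero    = + 1
one (suc _) = + 0

_^ₚ_ : PS → ℕ → PS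
a ^ₚ zero  = one
a ^ₚ suc m = a ⊛ (a ^ₚ m)

sub2 : PS → PS
sub2 a n = if n % 2 ≡ᵇ 0 then a (n / 2) else + 0

-- 1/(1 - q^(suc j)) = Σ_k q^{(suc j) k}
geom : ℕ → PS
geom j n = if n % suc j ≡ᵇ 0 then + 1 else + 0

-- ∏_{j=1}^{J} 1/(1 - q^j)
geomProd : ℕ → PS
geomProd zero    = one
geomProd (suc J) = geom J ⊛ geomProd J

-- ∏_{n≥1} 1/(1 - q^n) ; coefficient of q^n only involves factors j ≤ n
eulerInv : PS
eulerInv n = geomProd n n

-- q^{m/24} / η(q)^m = ∏_{n≥1} (1 - q^n)^{-m}
etaInvPow : ℕ → PS
etaInvPow m = eulerInv ^ₚ m

box : ℕ → List ℤ
box B = map (λ i → (+ i) ℤ.- (+ B)) (upTo (suc (B ℕ.+ B)))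

vecs : (m : ℕ) → List ℤ → List (Vec ℤ m)
vecs zero    xs = [] ∷ []
vecs (suc m) xs = concatMap (λ x → map (x ∷_) (vecs m xs)) xs

sq : ∀ {m} → Vec ℤ m → ℤ
sq []       = + 0
sq (x ∷ xs) = x ℤ.* x ℤ.+ sq xs

coordSum : ∀ {m} → Vec ℤ m → ℤ
coordSum []       = + 0
coordSum (x ∷ xs) = x ℤ.+ coordSum xs

isEven : ℤ → Bool
isEven x = ∣ x ∣ % 2 ≡ᵇ 0

allV : ∀ {m} → (ℤ → Bool) → Vec ℤ m → Bool
allV p []       = true
allV p (x ∷ xs) = p x ∧ allV p xs

_≡ℤᵇ_ : ℤ → ℤ → Bool
(+ a) ≡ℤᵇ (+ b) = a ≡ᵇ b
ℤ.-[1+ a ] ≡ℤᵇ ℤ.-[1+ b ] = a ≡ᵇ b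
_ ≡ℤᵇ _ = false

count : ∀ {A : Set} → (A → Bool) → List A → ℤ
count p xs = + length (filterᵇ p xs)

-- Theta series θ_M(q) = Σ_{λ∈M} q^{⟨λ,λ⟩/2}; coefficient of q^n
-- = #{λ ∈ M : ⟨λ,λ⟩ = 2n}.  In each case all such λ lie in the
-- enumerated box (an integer coordinate x has |x| ≤ x²).

-- A₁(2)^m = ℤ^m with ⟨x,x⟩ = 2 x·x
thetaA : ℕ → PS
thetaA m n = count (λ x → (+ 2 ℤ.* sq x) ≡ℤᵇ (+ (2 ℕ.* n))) (vecs m (box n))

-- D_m^*(2) = ℤ^m ∪ (ℤ+1/2)^m with form 2(standard).  Write λ = y/2 with
-- y ∈ ℤ^m having all coordinates of the same parity; ⟨λ,λ⟩ = 2·(y·y/4) = y·y/2.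
-- ⟨λ,λ⟩ = 2n  ⇔  y·y = 4n.
sameParity : ∀ {m} → Vec ℤ m → Bool
sameParity y = allV isEven y ∨ allV (λ x → not (isEven x)) y

thetaDdual2 : ℕ → PS
thetaDdual2 m n =
  count (λ y → sameParity y ∧ (sq y ≡ℤᵇ (+ (4 ℕ.* n)))) (vecs m (box (4 ℕ.* n)))

-- D_m = {x ∈ ℤ^m : Σ x_i even} with standard form; ⟨x,x⟩ = x·x = 2n
thetaD : ℕ → PS
thetaD m n =
  count (λ x → isEven (coordSum x) ∧ (sq x ≡ℤᵇ (+ (2 ℕ.* n)))) (vecs m (box (2 ℕ.* n)))

-- The three functions, with m = N/2.  Each equals q^{-N/24} Σ c_n q^n,
-- since 1/η(q²)^m = q^{-m/12} ∏(1-q^{2k})^{-m} and m/12 = N/24.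
-- cX N n is the coefficient c_n.

cA : ℕ → PS
cA N = thetaA (N / 2) ⊛ sub2 (etaInvPow (N / 2))

cD : ℕ → PS
cD N = thetaDdual2 (N / 2) ⊛ sub2 (etaInvPow (N / 2))

cV : ℕ → PS
cV N = sub2 (thetaD (N / 2) ⊛ etaInvPow (N / 2))

{-# OPTIONS --safe #-}
-- Write a vector of D*_m(2) as y/2 with y ∈ ℤ^m having all coordinates of one parity. The
-- even coset is a copy of A₁(2)^m = ℤ^m(2), while a vector of the odd coset has norm y·y/2 with
-- y·y ≡ m (mod 8), so it contributes to the coefficient of q^n only if 4n ≡ m (mod 8). For
-- m = N/2 ≡ 4 (mod 8) this forces n odd, and for m ≡ 0 (mod 8) it forces n even. Since
-- η(q²)^{-m} has only even powers of q, the coefficient c_n of θ/η(q²)^m only involves theta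
-- coefficients of the parity of n, which gives (1). For (2): a vector of ℤ^m of norm 2j has even
-- coordinate sum, so θ_{A₁(2)^m}(q) and θ_{D_m}(q²) agree at even powers of q.
module Submission where

open import Defs
open import Data.Bool using (Bool; true; false; T; not; _∧_; _∨_; if_then_else_)
open import Data.Bool.Properties using (T-∧; T-≡)
open import Data.Empty using (⊥; ⊥-elim)
open import Data.Integer as ℤ using (ℤ; +_; -[1+_]; ∣_∣)
import Data.Integer.Properties as ℤ
import Data.Integer.Tactic.RingSolver as ℤ-Solver
open import Data.List using (List; []; _∷_; _++_; [_]; _∷ʳ_; map; concatMap; length; filterᵇ; upTo; applyUpTo)
import Data.List.Properties as List
open import Data.List.Relation.Unary.All as All using (All)
open import Data.List.Relation.Unary.All.Properties using (++⁺)
open import Data.Nat as ℕ using (ℕ; zero; suc; _+_; _*_; _∸_; _≤_; _<_; _≡ᵇ_; _≤ᵇ_; z≤n; s≤s; NonZero)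
import Data.Nat.Properties as ℕ
open import Data.Nat.Tactic.RingSolver using (solve-∀)
open import Data.Nat.DivMod
  using (_%_; _/_; %-distribˡ-+; %-distribˡ-*; m%n<n; m%n%n≡m%n; m*n%n≡0; [m+kn]%n≡m%n; m*n/n≡m;
         m≡m%n+[m/n]*n; m∣n⇒o%n%m≡o%m; m%[n*o]/o≡m/o%n; m%n*o≡m*o%[n*o])
open import Data.Nat.Divisibility using (_∣_; divides)
open import Data.Product using (_×_; ∃; _,_; proj₂)
open import Data.Sum using (_⊎_; inj₁; inj₂)
open import Data.Unit using (tt)
open import Data.Vec as Vec using (Vec; []; _∷_)
open import Function using (_∘_; _⇔_; mk⇔; Equivalence)
open import Relation.Binary.PropositionalEquality
  using (_≡_; _≢_; refl; sym; trans; cong; cong₂; subst; subst₂; module ≡-Reasoning)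
open import Relation.Nullary using (¬_; contradiction)
open import Relation.Nullary.Decidable using (T?)

private variable
  A B : Set

2*n%2≡0 : ∀ n → (2 * n) % 2 ≡ 0
2*n%2≡0 n = trans (cong (_% 2) (ℕ.*-comm 2 n)) (m*n%n≡0 n 2)

1+2*n%2≡1 : ∀ n → suc (2 * n) % 2 ≡ 1
1+2*n%2≡1 n = trans (cong (λ k → suc k % 2) (ℕ.*-comm 2 n)) ([m+kn]%n≡m%n 1 n 2)

n%2≡0⊎n%2≡1 : ∀ n → n % 2 ≡ 0 ⊎ n % 2 ≡ 1
n%2≡0⊎n%2≡1 n with n % 2 | m%n<n n 2
... | 0 | _ = inj₁ refl
... | 1 | _ = inj₂ refl
... | suc (suc _) | s≤s (s≤s ())

n%2≡0⇒n≡2*[n/2] : ∀ n → n % 2 ≡ 0 → n ≡ 2 * (n / 2)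
n%2≡0⇒n≡2*[n/2] n n%2≡0 = trans (m≡m%n+[m/n]*n n 2) (trans (cong (_+ (n / 2) * 2) n%2≡0) (ℕ.*-comm (n / 2) 2))

[4*n]%8≡[n%2]*4 : ∀ n → (4 * n) % 8 ≡ (n % 2) * 4
[4*n]%8≡[n%2]*4 n = trans (cong (_% 8) (ℕ.*-comm 4 n)) (sym (m%n*o≡m*o%[n*o] n 2 4))

[n/2]%8≡[n%16]/2 : ∀ n → (n / 2) % 8 ≡ (n % 16) / 2
[n/2]%8≡[n%16]/2 n = sym (m%[n*o]/o≡m/o%n n 8 2)

n%2≡1⇒n*n%8≡1 : ∀ n → n % 2 ≡ 1 → (n * n) % 8 ≡ 1
n%2≡1⇒n*n%8≡1 n n%2≡1 = trans (%-distribˡ-* n n 8)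
  (residues (n % 8) (m%n<n n 8) (trans (m∣n⇒o%n%m≡o%m 2 8 n (divides 4 refl)) n%2≡1))
  where
  residues : ∀ r → r < 8 → r % 2 ≡ 1 → (r * r) % 8 ≡ 1
  residues 1 _ _ = refl
  residues 3 _ _ = refl
  residues 5 _ _ = refl
  residues 7 _ _ = refl
  residues 0 _ ()
  residues 2 _ ()
  residues 4 _ ()
  residues 6 _ ()
  residues (suc (suc (suc (suc (suc (suc (suc (suc _)))))))) (s≤s (s≤s (s≤s (s≤s (s≤s (s≤s (s≤s (s≤s ())))))))) _

n≤n*n : ∀ n → n ≤ n * n
n≤n*n zero    = z≤n
n≤n*n (suc n) = ℕ.m≤m*n (suc n) (suc n)

n*n≡n+2*t : ∀ n → ∃ λ t → n * n ≡ n + 2 * t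
n*n≡n+2*t zero = 0 , refl
n*n≡n+2*t (suc n) with t , e ← n*n≡n+2*t n = t + n , (begin
  suc n * suc n              ≡⟨ expand n ⟩
  suc (n + n) + n * n        ≡⟨ cong (_+_ (suc (n + n))) e ⟩
  suc (n + n) + (n + 2 * t)  ≡⟨ regroup n t ⟩
  suc n + 2 * (t + n)        ∎)
  where
  open ≡-Reasoning
  expand : ∀ n → suc n * suc n ≡ suc (n + n) + n * n
  expand = solve-∀
  regroup : ∀ n t → suc (n + n) + (n + 2 * t) ≡ suc n + 2 * (t + n)
  regroup = solve-∀

+[n*n]≡+n+2*t : ∀ n → ∃ λ t → + (n * n) ≡ + n ℤ.+ + 2 ℤ.* t
+[n*n]≡+n+2*t n with t , e ← n*n≡n+2*t n =
  + t , trans (cong +_ e) (trans (ℤ.pos-+ n (2 * t)) (cong (ℤ._+_ (+ n)) (ℤ.pos-* 2 t)))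

∣x∣*∣x∣≡x+2*t : ∀ x → ∃ λ t → + (∣ x ∣ * ∣ x ∣) ≡ x ℤ.+ + 2 ℤ.* t
∣x∣*∣x∣≡x+2*t (+ n)    = +[n*n]≡+n+2*t n
∣x∣*∣x∣≡x+2*t -[1+ n ] with t , e ← +[n*n]≡+n+2*t (suc n) = + suc n ℤ.+ t , trans e (negate (+ suc n) t)
  where
  negate : ∀ a t → a ℤ.+ + 2 ℤ.* t ≡ ℤ.- a ℤ.+ + 2 ℤ.* (a ℤ.+ t)
  negate = ℤ-Solver.solve-∀

≰⇒≤ᵇ≡false : ∀ {m n} → ¬ m ≤ n → (m ≤ᵇ n) ≡ false
≰⇒≤ᵇ≡false {m} {n} m≰n with m ≤ᵇ n in eq
... | false = refl
... | true  = contradiction (ℕ.≤ᵇ⇒≤ m n (subst T (sym eq) tt)) m≰n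

T-*-≡ᵇ-cancelˡ : ∀ k m n .{{_ : NonZero k}} → T (k * m ≡ᵇ k * n) ⇔ T (m ≡ᵇ n)
T-*-≡ᵇ-cancelˡ k m n = mk⇔
  (λ h → ℕ.≡⇒≡ᵇ m n (ℕ.*-cancelˡ-≡ m n k (ℕ.≡ᵇ⇒≡ _ _ h)))
  (λ h → ℕ.≡⇒≡ᵇ _ _ (cong (k *_) (ℕ.≡ᵇ⇒≡ m n h)))

filterᵇ-≐ : {p q : A → Bool} → (∀ x → T (p x) ⇔ T (q x)) → ∀ xs → filterᵇ p xs ≡ filterᵇ q xs
filterᵇ-≐ {p = p} {q} p⇔q =
  List.filter-≐ (T? ∘ p) (T? ∘ q) ((λ {x} → Equivalence.to (p⇔q x)) , λ {x} → Equivalence.from (p⇔q x))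

filterᵇ-∧ : (p q : A → Bool) → ∀ xs → filterᵇ (λ x → p x ∧ q x) xs ≡ filterᵇ q (filterᵇ p xs)
filterᵇ-∧ p q [] = refl
filterᵇ-∧ p q (x ∷ xs) with p x
... | false = filterᵇ-∧ p q xs
... | true with q x
...   | false = filterᵇ-∧ p q xs
...   | true  = cong (x ∷_) (filterᵇ-∧ p q xs)

filterᵇ-map : (p : B → Bool) (f : A → B) → ∀ xs → filterᵇ p (map f xs) ≡ map f (filterᵇ (p ∘ f) xs)
filterᵇ-map p f [] = refl
filterᵇ-map p f (x ∷ xs) with p (f x)
... | false = filterᵇ-map p f xs
... | true  = cong (f x ∷_) (filterᵇ-map p f xs)

filterᵇ-false : ∀ (xs : List A) → filterᵇ (λ _ → false) xs ≡ []
filterᵇ-false [] = refl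
filterᵇ-false (x ∷ xs) = filterᵇ-false xs

filterᵇ-concatMap : (p : B → Bool) (f : A → List B) → ∀ xs →
  filterᵇ p (concatMap f xs) ≡ concatMap (filterᵇ p ∘ f) xs
filterᵇ-concatMap p f [] = refl
filterᵇ-concatMap p f (x ∷ xs) =
  trans (List.filter-++ (T? ∘ p) (f x) (concatMap f xs)) (cong (filterᵇ p (f x) ++_) (filterᵇ-concatMap p f xs))

concatMap-if : (p : A → Bool) (f : A → List B) → ∀ xs →
  concatMap (λ x → if p x then f x else []) xs ≡ concatMap f (filterᵇ p xs)
concatMap-if p f [] = refl
concatMap-if p f (x ∷ xs) with p x
... | false = concatMap-if p f xs
... | true  = cong (f x ++_) (concatMap-if p f xs)

filterᵇ-accept-ends : (p : A → Bool) (x y : A) → p x ≡ true → p y ≡ true → ∀ xs →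
  filterᵇ p (x ∷ (xs ∷ʳ y)) ≡ x ∷ (filterᵇ p xs ∷ʳ y)
filterᵇ-accept-ends p x y px py xs rewrite px =
  cong (x ∷_) (trans (List.filter-++ (T? ∘ p) xs [ y ]) (cong (filterᵇ p xs ++_) (px⇒ py)))
  where
  px⇒ : p y ≡ true → filterᵇ p [ y ] ≡ [ y ]
  px⇒ e rewrite e = refl

filterᵇ-reject-ends : (p : A → Bool) (x y : A) → p x ≡ false → p y ≡ false → ∀ xs →
  filterᵇ p (x ∷ (xs ∷ʳ y)) ≡ filterᵇ p xs
filterᵇ-reject-ends p x y px py xs rewrite px =
  trans (List.filter-++ (T? ∘ p) xs [ y ]) (trans (cong (filterᵇ p xs ++_) (py⇒ py)) (List.++-identityʳ _))
  where
  py⇒ : p y ≡ false → filterᵇ p [ y ] ≡ []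
  py⇒ e rewrite e = refl

filterᵇ-allV-vecs : ∀ m (p : ℤ → Bool) xs → filterᵇ (allV p) (vecs m xs) ≡ vecs m (filterᵇ p xs)
filterᵇ-allV-vecs zero p xs = refl
filterᵇ-allV-vecs (suc m) p xs = begin
  filterᵇ (allV p) (concatMap (λ x → map (x Vec.∷_) (vecs m xs)) xs)
    ≡⟨ filterᵇ-concatMap (allV p) _ xs ⟩
  concatMap (λ x → filterᵇ (allV p) (map (x Vec.∷_) (vecs m xs))) xs
    ≡⟨ List.concatMap-cong filter-cons xs ⟩
  concatMap (λ x → if p x then map (x Vec.∷_) (vecs m (filterᵇ p xs)) else []) xs
    ≡⟨ concatMap-if p _ xs ⟩
  vecs (suc m) (filterᵇ p xs) ∎
  where
  open ≡-Reasoning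
  filter-cons : ∀ x → filterᵇ (allV p) (map (x Vec.∷_) (vecs m xs))
                    ≡ (if p x then map (x Vec.∷_) (vecs m (filterᵇ p xs)) else [])
  filter-cons x rewrite filterᵇ-map (allV p) (x Vec.∷_) (vecs m xs) with p x
  ... | true  = cong (map (x Vec.∷_)) (filterᵇ-allV-vecs m p xs)
  ... | false = cong (map (x Vec.∷_)) (filterᵇ-false (vecs m xs))

vecs-map : ∀ m (f : ℤ → ℤ) xs → vecs m (map f xs) ≡ map (Vec.map f) (vecs m xs)
vecs-map zero f xs = refl
vecs-map (suc m) f xs = begin
  concatMap (λ y → map (y Vec.∷_) (vecs m (map f xs))) (map f xs)
    ≡⟨ List.concatMap-map _ f xs ⟩
  concatMap (λ x → map (f x Vec.∷_) (vecs m (map f xs))) xs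
    ≡⟨ List.concatMap-cong cons-map xs ⟩
  concatMap (λ x → map (Vec.map f) (map (x Vec.∷_) (vecs m xs))) xs
    ≡⟨ List.map-concatMap (Vec.map f) _ xs ⟨
  map (Vec.map f) (vecs (suc m) xs) ∎
  where
  open ≡-Reasoning
  cons-map : ∀ x → map (f x Vec.∷_) (vecs m (map f xs)) ≡ map (Vec.map f) (map (x Vec.∷_) (vecs m xs))
  cons-map x = trans (cong (map (f x Vec.∷_)) (vecs-map m f xs))
                     (trans (sym (List.map-∘ (vecs m xs))) (List.map-∘ (vecs m xs)))

box-suc : ∀ b → box (suc b) ≡ -[1+ b ] ∷ (box b ∷ʳ + suc b)
box-suc b = begin
  map (λ i → + i ℤ.- + suc b) (upTo (suc (suc b + suc b)))
    ≡⟨ List.map-upTo (λ i → + i ℤ.- + suc b) _ ⟩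
  applyUpTo (λ i → + i ℤ.- + suc b) (suc (suc b + suc b))
    ≡⟨ cong (λ n → applyUpTo (λ i → + i ℤ.- + suc b) (suc (suc n))) (ℕ.+-suc b b) ⟩
  -[1+ b ] ∷ applyUpTo (λ i → + suc i ℤ.- + suc b) (suc (suc (b + b)))
    ≡⟨ cong (-[1+ b ] ∷_) (List.map-upTo (λ i → + suc i ℤ.- + suc b) _) ⟨
  -[1+ b ] ∷ map (λ i → + suc i ℤ.- + suc b) (upTo (suc (suc (b + b))))
    ≡⟨ cong (-[1+ b ] ∷_) (List.map-cong (λ i → shift (+ i) (+ b)) (upTo (suc (suc (b + b))))) ⟩
  -[1+ b ] ∷ map (λ i → + i ℤ.- + b) (upTo (suc (suc (b + b))))
    ≡⟨ cong (λ xs → -[1+ b ] ∷ map (λ i → + i ℤ.- + b) xs) (List.upTo-∷ʳ (suc (b + b))) ⟨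
  -[1+ b ] ∷ map (λ i → + i ℤ.- + b) (upTo (suc (b + b)) ∷ʳ suc (b + b))
    ≡⟨ cong (-[1+ b ] ∷_) (List.map-++ (λ i → + i ℤ.- + b) (upTo (suc (b + b))) _) ⟩
  -[1+ b ] ∷ (box b ∷ʳ (+ suc (b + b) ℤ.- + b))
    ≡⟨ cong (λ x → -[1+ b ] ∷ (box b ∷ʳ x)) (top (+ b)) ⟩
  -[1+ b ] ∷ (box b ∷ʳ + suc b) ∎
  where
  open ≡-Reasoning
  shift : ∀ i b → (ℤ.1ℤ ℤ.+ i) ℤ.- (ℤ.1ℤ ℤ.+ b) ≡ i ℤ.- b
  shift = ℤ-Solver.solve-∀
  top : ∀ b → (ℤ.1ℤ ℤ.+ (b ℤ.+ b)) ℤ.- b ≡ ℤ.1ℤ ℤ.+ b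
  top = ℤ-Solver.solve-∀

box-bounded : ∀ b → All (λ x → ∣ x ∣ ≤ b) (box b)
box-bounded zero = ℕ.≤-refl All.∷ All.[]
box-bounded (suc b) rewrite box-suc b =
  ℕ.≤-refl All.∷ ++⁺ (All.map ℕ.m≤n⇒m≤1+n (box-bounded b)) (ℕ.≤-refl All.∷ All.[])

filterᵇ-≤ᵇ-box : ∀ {b b′} → b ≤ b′ → filterᵇ (λ x → ∣ x ∣ ≤ᵇ b) (box b′) ≡ box b
filterᵇ-≤ᵇ-box {b} b≤b′ = go (ℕ.≤⇒≤′ b≤b′)
  where
  small : ℤ → Bool
  small x = ∣ x ∣ ≤ᵇ b
  go : ∀ {b′} → b ℕ.≤′ b′ → filterᵇ small (box b′) ≡ box b
  go ℕ.≤′-refl = List.filter-all (T? ∘ small) (All.map ℕ.≤⇒≤ᵇ (box-bounded b))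
  go (ℕ.≤′-step {b′} b≤′b′) = begin
    filterᵇ small (box (suc b′))
      ≡⟨ cong (filterᵇ small) (box-suc b′) ⟩
    filterᵇ small (-[1+ b′ ] ∷ (box b′ ∷ʳ + suc b′))
      ≡⟨ filterᵇ-reject-ends small -[1+ b′ ] (+ suc b′) outside outside (box b′) ⟩
    filterᵇ small (box b′)
      ≡⟨ go b≤′b′ ⟩
    box b ∎
    where
    open ≡-Reasoning
    outside : (suc b′ ≤ᵇ b) ≡ false
    outside = ≰⇒≤ᵇ≡false (ℕ.<⇒≱ (s≤s (ℕ.≤′⇒≤ b≤′b′)))

isEven-[2+2*j] : ∀ j → isEven (+ (2 + 2 * j)) ≡ true
isEven-[2+2*j] j = cong (_≡ᵇ 0) (trans (cong (_% 2) (sym (ℕ.*-suc 2 j))) (2*n%2≡0 (suc j)))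

isEven-[1+2*j] : ∀ j → isEven (+ suc (2 * j)) ≡ false
isEven-[1+2*j] j = cong (_≡ᵇ 0) (1+2*n%2≡1 j)

filterᵇ-isEven-box : ∀ b → filterᵇ isEven (box (2 * b)) ≡ map (+ 2 ℤ.*_) (box b)
filterᵇ-isEven-box zero = refl
filterᵇ-isEven-box (suc b) = begin
  filterᵇ isEven (box (2 * suc b))
    ≡⟨ cong (filterᵇ isEven ∘ box) (ℕ.*-suc 2 b) ⟩
  filterᵇ isEven (box (suc (suc (2 * b))))
    ≡⟨ cong (filterᵇ isEven) (trans (box-suc _) (cong (λ xs → -[1+ suc (2 * b) ] ∷ (xs ∷ʳ + (2 + 2 * b))) (box-suc _))) ⟩
  filterᵇ isEven (-[1+ suc (2 * b) ] ∷ ((-[1+ 2 * b ] ∷ (box (2 * b) ∷ʳ + suc (2 * b))) ∷ʳ + (2 + 2 * b)))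
    ≡⟨ filterᵇ-accept-ends isEven -[1+ suc (2 * b) ] (+ (2 + 2 * b)) (isEven-[2+2*j] b) (isEven-[2+2*j] b) _ ⟩
  -[1+ suc (2 * b) ] ∷ (filterᵇ isEven (-[1+ 2 * b ] ∷ (box (2 * b) ∷ʳ + suc (2 * b))) ∷ʳ + (2 + 2 * b))
    ≡⟨ cong (λ xs → -[1+ suc (2 * b) ] ∷ (xs ∷ʳ + (2 + 2 * b)))
         (trans (filterᵇ-reject-ends isEven -[1+ 2 * b ] (+ suc (2 * b)) (isEven-[1+2*j] b) (isEven-[1+2*j] b) _) (filterᵇ-isEven-box b)) ⟩
  -[1+ suc (2 * b) ] ∷ (map (+ 2 ℤ.*_) (box b) ∷ʳ + (2 + 2 * b))
    ≡⟨ cong₂ (λ x y → x ∷ (map (+ 2 ℤ.*_) (box b) ∷ʳ y)) double-neg double-pos ⟨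
  + 2 ℤ.* -[1+ b ] ∷ (map (+ 2 ℤ.*_) (box b) ∷ʳ + 2 ℤ.* + suc b)
    ≡⟨ cong (+ 2 ℤ.* -[1+ b ] ∷_) (List.map-++ (+ 2 ℤ.*_) (box b) _) ⟨
  map (+ 2 ℤ.*_) (-[1+ b ] ∷ (box b ∷ʳ + suc b))
    ≡⟨ cong (map (+ 2 ℤ.*_)) (box-suc b) ⟨
  map (+ 2 ℤ.*_) (box (suc b)) ∎
  where
  open ≡-Reasoning
  double-pos : + 2 ℤ.* + suc b ≡ + (2 + 2 * b)
  double-pos = trans (sym (ℤ.pos-* 2 (suc b))) (cong +_ (ℕ.*-suc 2 b))
  double-neg : + 2 ℤ.* -[1+ b ] ≡ -[1+ suc (2 * b) ]
  double-neg = trans (sym (ℤ.neg-distribʳ-* (+ 2) (+ suc b))) (cong ℤ.-_ double-pos)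

-- Norms and theta series

∥_∥² : ∀ {m} → Vec ℤ m → ℕ
∥ [] ∥²     = 0
∥ x ∷ v ∥² = ∣ x ∣ * ∣ x ∣ + ∥ v ∥²

hasNormSq : ∀ {m} → ℕ → Vec ℤ m → Bool
hasNormSq c v = ∥ v ∥² ≡ᵇ c

sq≡∥∥² : ∀ {m} (v : Vec ℤ m) → sq v ≡ + ∥ v ∥²
sq≡∥∥² [] = refl
sq≡∥∥² (x ∷ v) = cong₂ ℤ._+_ (x*x≡∣x∣*∣x∣ x) (sq≡∥∥² v)
  where
  x*x≡∣x∣*∣x∣ : ∀ x → x ℤ.* x ≡ + (∣ x ∣ * ∣ x ∣)
  x*x≡∣x∣*∣x∣ (+ n)    = sym (ℤ.pos-* n n)
  x*x≡∣x∣*∣x∣ -[1+ n ] = refl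

sq≡ℤᵇ≡hasNormSq : ∀ {m} c (v : Vec ℤ m) → (sq v ≡ℤᵇ (+ c)) ≡ hasNormSq c v
sq≡ℤᵇ≡hasNormSq c v rewrite sq≡∥∥² v = refl

∥v∥²≤c⇒coords≤c : ∀ {m c} (v : Vec ℤ m) → ∥ v ∥² ≤ c → T (allV (λ x → ∣ x ∣ ≤ᵇ c) v)
∥v∥²≤c⇒coords≤c []      _ = _
∥v∥²≤c⇒coords≤c (x ∷ v) h = Equivalence.from T-∧
  ( ℕ.≤⇒≤ᵇ (ℕ.≤-trans (n≤n*n ∣ x ∣) (ℕ.≤-trans (ℕ.m≤m+n _ ∥ v ∥²) h))
  , ∥v∥²≤c⇒coords≤c v (ℕ.≤-trans (ℕ.m≤n+m ∥ v ∥² _) h))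

filterᵇ-hasNormSq-box : ∀ m {c b} → c ≤ b →
  filterᵇ (hasNormSq c) (vecs m (box b)) ≡ filterᵇ (hasNormSq c) (vecs m (box c))
filterᵇ-hasNormSq-box m {c} {b} c≤b = begin
  filterᵇ (hasNormSq c) (vecs m (box b))
    ≡⟨ filterᵇ-≐ (λ v → mk⇔ (λ h → Equivalence.from T-∧ (inBox v h , h)) (proj₂ ∘ Equivalence.to T-∧)) (vecs m (box b)) ⟩
  filterᵇ (λ v → allV small v ∧ hasNormSq c v) (vecs m (box b))
    ≡⟨ filterᵇ-∧ (allV small) (hasNormSq c) (vecs m (box b)) ⟩
  filterᵇ (hasNormSq c) (filterᵇ (allV small) (vecs m (box b)))
    ≡⟨ cong (filterᵇ (hasNormSq c)) (filterᵇ-allV-vecs m small (box b)) ⟩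
  filterᵇ (hasNormSq c) (vecs m (filterᵇ small (box b)))
    ≡⟨ cong (filterᵇ (hasNormSq c) ∘ vecs m) (filterᵇ-≤ᵇ-box c≤b) ⟩
  filterᵇ (hasNormSq c) (vecs m (box c)) ∎
  where
  open ≡-Reasoning
  small : ℤ → Bool
  small x = ∣ x ∣ ≤ᵇ c
  inBox : ∀ v → T (hasNormSq c v) → T (allV small v)
  inBox v h = ∥v∥²≤c⇒coords≤c v (ℕ.≤-reflexive (ℕ.≡ᵇ⇒≡ _ _ h))

∥2v∥²≡4∥v∥² : ∀ {m} (v : Vec ℤ m) → ∥ Vec.map (+ 2 ℤ.*_) v ∥² ≡ 4 * ∥ v ∥²
∥2v∥²≡4∥v∥² [] = refl
∥2v∥²≡4∥v∥² (x ∷ v) = begin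
  ∣ + 2 ℤ.* x ∣ * ∣ + 2 ℤ.* x ∣ + ∥ Vec.map (+ 2 ℤ.*_) v ∥²
    ≡⟨ cong₂ (λ a s → a * a + s) (ℤ.abs-* (+ 2) x) (∥2v∥²≡4∥v∥² v) ⟩
  (2 * ∣ x ∣) * (2 * ∣ x ∣) + 4 * ∥ v ∥²
    ≡⟨ expand ∣ x ∣ ∥ v ∥² ⟩
  4 * (∣ x ∣ * ∣ x ∣ + ∥ v ∥²) ∎
  where
  open ≡-Reasoning
  expand : ∀ a s → (2 * a) * (2 * a) + 4 * s ≡ 4 * (a * a + s)
  expand = solve-∀

-- An all-even vector of norm 4n is twice a vector of norm n, and those already lie in box n.
count-allEven-hasNormSq : ∀ m n →
  length (filterᵇ (λ y → allV isEven y ∧ hasNormSq (4 * n) y) (vecs m (box (4 * n))))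
  ≡ length (filterᵇ (hasNormSq n) (vecs m (box n)))
count-allEven-hasNormSq m n = begin
  length (filterᵇ (λ y → allV isEven y ∧ hasNormSq (4 * n) y) (vecs m (box (4 * n))))
    ≡⟨ cong length (filterᵇ-∧ (allV isEven) (hasNormSq (4 * n)) (vecs m (box (4 * n)))) ⟩
  length (filterᵇ (hasNormSq (4 * n)) (filterᵇ (allV isEven) (vecs m (box (4 * n)))))
    ≡⟨ cong (length ∘ filterᵇ (hasNormSq (4 * n))) (filterᵇ-allV-vecs m isEven (box (4 * n))) ⟩
  length (filterᵇ (hasNormSq (4 * n)) (vecs m (filterᵇ isEven (box (4 * n)))))
    ≡⟨ cong (λ xs → length (filterᵇ (hasNormSq (4 * n)) (vecs m (filterᵇ isEven (box xs)))))
            (ℕ.*-assoc 2 2 n) ⟩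
  length (filterᵇ (hasNormSq (4 * n)) (vecs m (filterᵇ isEven (box (2 * (2 * n))))))
    ≡⟨ cong (λ xs → length (filterᵇ (hasNormSq (4 * n)) (vecs m xs))) (filterᵇ-isEven-box (2 * n)) ⟩
  length (filterᵇ (hasNormSq (4 * n)) (vecs m (map (+ 2 ℤ.*_) (box (2 * n)))))
    ≡⟨ cong (length ∘ filterᵇ (hasNormSq (4 * n))) (vecs-map m (+ 2 ℤ.*_) (box (2 * n))) ⟩
  length (filterᵇ (hasNormSq (4 * n)) (map (Vec.map (+ 2 ℤ.*_)) (vecs m (box (2 * n)))))
    ≡⟨ cong length (filterᵇ-map (hasNormSq (4 * n)) (Vec.map (+ 2 ℤ.*_)) (vecs m (box (2 * n)))) ⟩
  length (map (Vec.map (+ 2 ℤ.*_)) (filterᵇ (hasNormSq (4 * n) ∘ Vec.map (+ 2 ℤ.*_)) (vecs m (box (2 * n)))))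
    ≡⟨ List.length-map (Vec.map (+ 2 ℤ.*_)) (filterᵇ (hasNormSq (4 * n) ∘ Vec.map (+ 2 ℤ.*_)) (vecs m (box (2 * n)))) ⟩
  length (filterᵇ (hasNormSq (4 * n) ∘ Vec.map (+ 2 ℤ.*_)) (vecs m (box (2 * n))))
    ≡⟨ cong length (filterᵇ-≐ doubled (vecs m (box (2 * n)))) ⟩
  length (filterᵇ (hasNormSq n) (vecs m (box (2 * n))))
    ≡⟨ cong length (filterᵇ-hasNormSq-box m (ℕ.m≤n*m n 2)) ⟩
  length (filterᵇ (hasNormSq n) (vecs m (box n))) ∎
  where
  open ≡-Reasoning
  doubled : ∀ v → T (hasNormSq (4 * n) (Vec.map (+ 2 ℤ.*_) v)) ⇔ T (hasNormSq n v)
  doubled v rewrite ∥2v∥²≡4∥v∥² v = T-*-≡ᵇ-cancelˡ 4 ∥ v ∥² n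

thetaA≡count : ∀ m n → thetaA m n ≡ + length (filterᵇ (hasNormSq n) (vecs m (box n)))
thetaA≡count m n = cong (+_ ∘ length) (filterᵇ-≐ cancel2 (vecs m (box n)))
  where
  cancel2 : ∀ x → T ((+ 2 ℤ.* sq x) ≡ℤᵇ (+ (2 * n))) ⇔ T (hasNormSq n x)
  cancel2 x rewrite sq≡∥∥² x | sym (ℤ.pos-* 2 ∥ x ∥²) = T-*-≡ᵇ-cancelˡ 2 ∥ x ∥² n

∥v∥²≡coordSum+2*K : ∀ {m} (v : Vec ℤ m) → ∃ λ K → + ∥ v ∥² ≡ coordSum v ℤ.+ + 2 ℤ.* K
∥v∥²≡coordSum+2*K [] = + 0 , refl
∥v∥²≡coordSum+2*K (x ∷ v) with t , e ← ∣x∣*∣x∣≡x+2*t x | K , e′ ← ∥v∥²≡coordSum+2*K v =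
  t ℤ.+ K , trans (ℤ.pos-+ (∣ x ∣ * ∣ x ∣) ∥ v ∥²) (trans (cong₂ ℤ._+_ e e′) (regroup x t (coordSum v) K))
  where
  regroup : ∀ x t c K → (x ℤ.+ + 2 ℤ.* t) ℤ.+ (c ℤ.+ + 2 ℤ.* K) ≡ (x ℤ.+ c) ℤ.+ + 2 ℤ.* (t ℤ.+ K)
  regroup = ℤ-Solver.solve-∀

isEven-2* : ∀ w → isEven (+ 2 ℤ.* w) ≡ true
isEven-2* w = cong (_≡ᵇ 0) (trans (cong (_% 2) (ℤ.abs-* (+ 2) w)) (2*n%2≡0 ∣ w ∣))

isEven-coordSum : ∀ {m} (v : Vec ℤ m) j → ∥ v ∥² ≡ 2 * j → isEven (coordSum v) ≡ true
isEven-coordSum v j ∥v∥²≡2j with K , e ← ∥v∥²≡coordSum+2*K v =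
  trans (cong isEven (solve-for-c (coordSum v) K (+ j) (trans (sym e) (trans (cong +_ ∥v∥²≡2j) (ℤ.pos-* 2 j)))))
        (isEven-2* (+ j ℤ.- K))
  where
  solve-for-c : ∀ c K j → c ℤ.+ + 2 ℤ.* K ≡ + 2 ℤ.* j → c ≡ + 2 ℤ.* (j ℤ.- K)
  solve-for-c c K j h = trans (move c K) (trans (cong (ℤ._+ + 2 ℤ.* ℤ.- K) h) (factor j K))
    where
    move : ∀ c K → c ≡ (c ℤ.+ + 2 ℤ.* K) ℤ.+ + 2 ℤ.* ℤ.- K
    move = ℤ-Solver.solve-∀
    factor : ∀ j K → + 2 ℤ.* j ℤ.+ + 2 ℤ.* ℤ.- K ≡ + 2 ℤ.* (j ℤ.- K)
    factor = ℤ-Solver.solve-∀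

thetaA[2j]≡thetaD[j] : ∀ m j → thetaA m (2 * j) ≡ thetaD m j
thetaA[2j]≡thetaD[j] m j =
  trans (thetaA≡count m (2 * j)) (cong (+_ ∘ length) (filterᵇ-≐ evenSum (vecs m (box (2 * j)))))
  where
  evenSum : ∀ x → T (hasNormSq (2 * j) x) ⇔ T (isEven (coordSum x) ∧ (sq x ≡ℤᵇ (+ (2 * j))))
  evenSum x rewrite sq≡ℤᵇ≡hasNormSq (2 * j) x = mk⇔
    (λ h → Equivalence.from T-∧ (Equivalence.from T-≡ (isEven-coordSum x j (ℕ.≡ᵇ⇒≡ _ _ h)) , h))
    (proj₂ ∘ Equivalence.to T-∧)

odd-∣x∣ : ∀ x → T (not (isEven x)) → ∣ x ∣ % 2 ≡ 1
odd-∣x∣ x odd with n%2≡0⊎n%2≡1 ∣ x ∣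
... | inj₂ e = e
... | inj₁ e = ⊥-elim (subst (λ r → T (not (r ≡ᵇ 0))) e odd)

allOdd⇒∥y∥²≡m[mod8] : ∀ {m} (y : Vec ℤ m) → T (allV (not ∘ isEven) y) → ∥ y ∥² % 8 ≡ m % 8
allOdd⇒∥y∥²≡m[mod8] [] _ = refl
allOdd⇒∥y∥²≡m[mod8] {suc m} (x ∷ y) odd with odd-x , odd-y ← Equivalence.to T-∧ odd = begin
  (∣ x ∣ * ∣ x ∣ + ∥ y ∥²) % 8
    ≡⟨ %-distribˡ-+ (∣ x ∣ * ∣ x ∣) ∥ y ∥² 8 ⟩
  ((∣ x ∣ * ∣ x ∣) % 8 + ∥ y ∥² % 8) % 8
    ≡⟨ cong₂ (λ a b → (a + b) % 8) (n%2≡1⇒n*n%8≡1 ∣ x ∣ (odd-∣x∣ x odd-x)) (allOdd⇒∥y∥²≡m[mod8] y odd-y) ⟩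
  (1 + m % 8) % 8
    ≡⟨ %-distribˡ-+ 1 m 8 ⟨
  suc m % 8 ∎
  where open ≡-Reasoning

thetaDdual2≡thetaA : ∀ m n → (4 * n) % 8 ≢ m % 8 → thetaDdual2 m n ≡ thetaA m n
thetaDdual2≡thetaA m n 4n≢m = begin
  thetaDdual2 m n
    ≡⟨ cong (+_ ∘ length) (filterᵇ-≐ evenCoset (vecs m (box (4 * n)))) ⟩
  + length (filterᵇ (λ y → allV isEven y ∧ hasNormSq (4 * n) y) (vecs m (box (4 * n))))
    ≡⟨ cong +_ (count-allEven-hasNormSq m n) ⟩
  + length (filterᵇ (hasNormSq n) (vecs m (box n)))
    ≡⟨ thetaA≡count m n ⟨
  thetaA m n ∎
  where
  open ≡-Reasoning
  noOddCoset : ∀ (y : Vec ℤ m) → T (allV (not ∘ isEven) y) → T (hasNormSq (4 * n) y) → ⊥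
  noOddCoset y odd h = 4n≢m (trans (cong (_% 8) (sym (ℕ.≡ᵇ⇒≡ ∥ y ∥² (4 * n) h))) (allOdd⇒∥y∥²≡m[mod8] y odd))
  ∨-∧-cancel : ∀ e o s → (T o → T s → ⊥) → T ((e ∨ o) ∧ s) ⇔ T (e ∧ s)
  ∨-∧-cancel true  o     s     _ = mk⇔ (λ h → h) (λ h → h)
  ∨-∧-cancel false false s     _ = mk⇔ (λ h → h) (λ h → h)
  ∨-∧-cancel false true  false _ = mk⇔ (λ h → h) (λ h → h)
  ∨-∧-cancel false true  true  f = contradiction _ (f _)
  evenCoset : ∀ y → T (sameParity y ∧ (sq y ≡ℤᵇ (+ (4 * n)))) ⇔ T (allV isEven y ∧ hasNormSq (4 * n) y)
  evenCoset y rewrite sq≡ℤᵇ≡hasNormSq (4 * n) y = ∨-∧-cancel _ _ _ (noOddCoset y)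

-- Power series in q²

Σ≤-cong : ∀ n {f g : ℕ → ℤ} → (∀ i → i ≤ n → f i ≡ g i) → Σ≤ n f ≡ Σ≤ n g
Σ≤-cong zero    f≡g = f≡g 0 z≤n
Σ≤-cong (suc n) f≡g = cong₂ ℤ._+_ (Σ≤-cong n (λ i i≤n → f≡g i (ℕ.m≤n⇒m≤1+n i≤n))) (f≡g (suc n) ℕ.≤-refl)

Σ≤-evens : ∀ k (f : ℕ → ℤ) → (∀ j → f (suc (2 * j)) ≡ + 0) → Σ≤ (2 * k) f ≡ Σ≤ k (f ∘ (2 *_))
Σ≤-evens zero    f odd≡0 = refl
Σ≤-evens (suc k) f odd≡0 = begin
  Σ≤ (2 * suc k) f
    ≡⟨ cong (λ n → Σ≤ n f) (ℕ.*-suc 2 k) ⟩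
  (Σ≤ (2 * k) f ℤ.+ f (suc (2 * k))) ℤ.+ f (2 + 2 * k)
    ≡⟨ cong₂ (λ s o → (s ℤ.+ o) ℤ.+ f (2 + 2 * k)) (Σ≤-evens k f odd≡0) (odd≡0 k) ⟩
  (Σ≤ k (f ∘ (2 *_)) ℤ.+ + 0) ℤ.+ f (2 + 2 * k)
    ≡⟨ cong₂ ℤ._+_ (ℤ.+-identityʳ (Σ≤ k (f ∘ (2 *_)))) (cong f (sym (ℕ.*-suc 2 k))) ⟩
  Σ≤ (suc k) (f ∘ (2 *_)) ∎
  where open ≡-Reasoning

sub2-even : ∀ a n → n % 2 ≡ 0 → sub2 a n ≡ a (n / 2)
sub2-even a n n%2≡0 rewrite n%2≡0 = refl

sub2-odd : ∀ a n → n % 2 ≡ 1 → sub2 a n ≡ + 0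
sub2-odd a n n%2≡1 rewrite n%2≡1 = refl

sub2-2* : ∀ a k → sub2 a (2 * k) ≡ a k
sub2-2* a k = trans (sub2-even a (2 * k) (2*n%2≡0 k)) (cong a (trans (cong (_/ 2) (ℕ.*-comm 2 k)) (m*n/n≡m k 2)))

⊛-sub2 : ∀ a b k → (a ⊛ b) k ≡ (sub2 a ⊛ sub2 b) (2 * k)
⊛-sub2 a b k = sym (begin
  Σ≤ (2 * k) (λ i → sub2 a i ℤ.* sub2 b (2 * k ∸ i))
    ≡⟨ Σ≤-evens k _ (λ j → cong (ℤ._* sub2 b (2 * k ∸ suc (2 * j))) (sub2-odd a (suc (2 * j)) (1+2*n%2≡1 j))) ⟩
  Σ≤ k (λ j → sub2 a (2 * j) ℤ.* sub2 b (2 * k ∸ 2 * j))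
    ≡⟨ Σ≤-cong k (λ j _ → cong₂ ℤ._*_ (sub2-2* a j) (trans (cong (sub2 b) (sym (ℕ.*-distribˡ-∸ 2 k j))) (sub2-2* b (k ∸ j)))) ⟩
  Σ≤ k (λ j → a j ℤ.* b (k ∸ j)) ∎)
  where open ≡-Reasoning

⊛-sub2-congˡ : ∀ a a′ b n → (∀ i → i % 2 ≡ n % 2 → a i ≡ a′ i) → (a ⊛ sub2 b) n ≡ (a′ ⊛ sub2 b) n
⊛-sub2-congˡ a a′ b n a≡a′ = Σ≤-cong n term
  where
  term : ∀ i → i ≤ n → a i ℤ.* sub2 b (n ∸ i) ≡ a′ i ℤ.* sub2 b (n ∸ i)
  term i i≤n with n%2≡0⊎n%2≡1 (n ∸ i)
  ... | inj₁ even = cong (ℤ._* sub2 b (n ∸ i)) (a≡a′ i (sym (begin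
        n % 2                      ≡⟨ cong (_% 2) (ℕ.m+[n∸m]≡n i≤n) ⟨
        (i + (n ∸ i)) % 2          ≡⟨ %-distribˡ-+ i (n ∸ i) 2 ⟩
        (i % 2 + (n ∸ i) % 2) % 2  ≡⟨ cong (λ r → (i % 2 + r) % 2) even ⟩
        (i % 2 + 0) % 2            ≡⟨ cong (_% 2) (ℕ.+-identityʳ (i % 2)) ⟩
        i % 2 % 2                  ≡⟨ m%n%n≡m%n i 2 ⟩
        i % 2                      ∎)))
    where open ≡-Reasoning
  ... | inj₂ odd = trans (vanish (a i)) (sym (vanish (a′ i)))
    where
    vanish : ∀ c → c ℤ.* sub2 b (n ∸ i) ≡ + 0
    vanish c = trans (cong (c ℤ.*_) (sub2-odd b (n ∸ i) odd)) (ℤ.*-zeroʳ c)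

thetaA≡sub2-thetaD : ∀ m i → i % 2 ≡ 0 → thetaA m i ≡ sub2 (thetaD m) i
thetaA≡sub2-thetaD m i i%2≡0 =
  trans (cong (thetaA m) (n%2≡0⇒n≡2*[n/2] i i%2≡0))
        (trans (thetaA[2j]≡thetaD[j] m (i / 2)) (sym (sub2-even (thetaD m) i i%2≡0)))

proposition8p3 : (N : ℕ) → 0 < N → 8 ∣ N →
    ((N % 16 ≡ 8) → (k : ℕ) → cA N (2 * k) ≡ cD N (2 * k))
    × ((N % 16 ≡ 0) → (k : ℕ) → cA N (suc (2 * k)) ≡ cD N (suc (2 * k)))
    × ((N % 16 ≡ 8) → (k : ℕ) → (cV N (2 * k) ≡ cA N (2 * k)) × (cV N (2 * k) ≡ cD N (2 * k)))
proposition8p3 N _ _ = A≡D-even , A≡D-odd , λ h k → V≡A k , trans (V≡A k) (A≡D-even h k)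
  where
  m = N / 2
  m%8≡ : ∀ {r} → N % 16 ≡ r → m % 8 ≡ r / 2
  m%8≡ N%16≡r = trans ([n/2]%8≡[n%16]/2 N) (cong (_/ 2) N%16≡r)
  A≡D-at : ∀ n → (n % 2) * 4 ≢ m % 8 → cA N n ≡ cD N n
  A≡D-at n gap = ⊛-sub2-congˡ (thetaA m) (thetaDdual2 m) (etaInvPow m) n λ i i≡n →
    sym (thetaDdual2≡thetaA m i λ 4i≡m → gap (trans (cong (_* 4) (sym i≡n)) (trans (sym ([4*n]%8≡[n%2]*4 i)) 4i≡m)))
  A≡D-even : N % 16 ≡ 8 → ∀ k → cA N (2 * k) ≡ cD N (2 * k)
  A≡D-even h k = A≡D-at (2 * k) (subst₂ (λ r s → r * 4 ≢ s) (sym (2*n%2≡0 k)) (sym (m%8≡ h)) λ ())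
  A≡D-odd : N % 16 ≡ 0 → ∀ k → cA N (suc (2 * k)) ≡ cD N (suc (2 * k))
  A≡D-odd h k = A≡D-at (suc (2 * k)) (subst₂ (λ r s → r * 4 ≢ s) (sym (1+2*n%2≡1 k)) (sym (m%8≡ h)) λ ())
  V≡A : ∀ k → cV N (2 * k) ≡ cA N (2 * k)
  V≡A k = begin
    sub2 (thetaD m ⊛ etaInvPow m) (2 * k)            ≡⟨ sub2-2* (thetaD m ⊛ etaInvPow m) k ⟩
    (thetaD m ⊛ etaInvPow m) k                        ≡⟨ ⊛-sub2 (thetaD m) (etaInvPow m) k ⟩
    (sub2 (thetaD m) ⊛ sub2 (etaInvPow m)) (2 * k)   ≡⟨ ⊛-sub2-congˡ (sub2 (thetaD m)) (thetaA m) (etaInvPow m) (2 * k)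
                                                           (λ i i≡2k → sym (thetaA≡sub2-thetaD m i (trans i≡2k (2*n%2≡0 k)))) ⟩
    cA N (2 * k)                                      ∎
    where open ≡-Reasoning
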